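{- Let $\mathcal{G}$ be a class of graphs of bounded expansion and let $c$ be a constant such that for every $G\in\mathcal{G}$ and every $X\subseteq V(G)$, the number of distinct sets $N(u)\cap X$ with $u\in V(G)\setminus X$ is at most $c|X|$. Let $(G,t,k,K)$ be an instance of \textsc{Annotated $p$-Bounded Harmless Set} with $G\in\mathcal{G}$. If $|K|<|V(G)|/(c+1)$, then there exists a vertex $v\in V(G)\setminus K$ such that $(G-v,\,t|_{V(G)\setminus\{v\}},\,k,\,K)$ is an equivalent instance.
   Context: \textsc{Annotated $p$-Bounded Harmless Set}: given a graph $G$, a threshold function $t\colon V(G)\to\{1,\dots,p\}$, an integer $k$ and a set $K\subseteq V(G)$, decide whether there is a set $S\subseteq K$ with $|S|\ge k$ such that every vertex $v\in V(G)$ has fewer than $t(v)$ neighbours in $S$. Two instances are equivalent if both are yes-instances or both are no-instances. Bounded expansion: for a graph $G$, $\nabla_r(G)=\sup_H\|H\|/|H|$ over all $r$-shallow minors $H$ of $G$; a class has bounded expansion if $\nabla_r$ is bounded on it by a function of $r$ alone (such a constant $c$ exists for every bounded expansion class). -}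

module Defs where

open import Data.Nat using (ℕ; zero; suc; pred; _+_; _*_; _≤_; _<_)
open import Data.Bool using (Bool; true; false; _∧_)
import Data.Bool.Properties as BoolP
open import Data.Fin using (Fin; zero; suc; punchIn; toℕ; _≟_)
open import Data.Fin.Subset using (Subset; _∈_; _∉_; _⊆_; _∩_; ∣_∣; Nonempty; Empty)
open import Data.Vec using (tabulate; lookup)
import Data.Vec.Properties as VecP
open import Data.List using (List; length; map; filter; deduplicate; allFin)
open import Data.Product using (Σ; ∃; _×_; _,_)
open import Relation.Binary.PropositionalEquality using (_≡_; _≢_)
open import Relation.Nullary using (¬_)
open import Relation.Nullary.Decidable using (¬?; ⌊_⌋)
open import Data.Fin.Subset.Properties using (_∈?_)
open import Data.Nat using (_<ᵇ_)

record Graph (n : ℕ) : Set where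
  field
    adj     : Fin n → Fin n → Bool
    sym     : ∀ u v → adj u v ≡ adj v u
    irrefl  : ∀ v → adj v v ≡ false
open Graph public

N : ∀ {n} → Graph n → Fin n → Subset n
N G u = tabulate (adj G u)

edgeCount : ∀ {n} → Graph n → ℕ
edgeCount {n} G = sumL (map (λ i → ∣ tabulate (λ j → adj G i j ∧ (toℕ j <ᵇ toℕ i)) ∣) (allFin n))
  where
  sumL : List ℕ → ℕ
  sumL List.[] = 0
  sumL (x List.∷ xs) = x + sumL xs

data Reach {n} (G : Graph n) (B : Subset n) : ℕ → Fin n → Fin n → Set where
  here : ∀ {r x} → Reach G B r x x
  step : ∀ {r x y z} → adj G x y ≡ true → y ∈ B → Reach G B r y z →
         Reach G B (suc r) x z

record ShallowMinor (r : ℕ) {m n : ℕ} (H : Graph m) (G : Graph n) : Set where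
  field
    branch   : Fin m → Subset n
    disjoint : ∀ i j → i ≢ j → Empty (branch i ∩ branch j)
    radius   : ∀ i → Σ (Fin n) λ c → c ∈ branch i ×
                 (∀ x → x ∈ branch i → Reach G (branch i) r c x)
    edges    : ∀ i j → adj H i j ≡ true →
                 Σ (Fin n) λ x → Σ (Fin n) λ y →
                   x ∈ branch i × y ∈ branch j × adj G x y ≡ true

GraphClass : Set₁
GraphClass = ∀ {n} → Graph n → Set

-- bounded expansion: ∇_r(G) ≤ f r for all G in the class, i.e.
-- ‖H‖ ≤ f r · |H| for every r-shallow minor H of G
-- (a real bound f r may be replaced by its ceiling).
BoundedExpansion : GraphClass → Set
BoundedExpansion 𝒢 = Σ (ℕ → ℕ) λ f →
  ∀ {n} (G : Graph n) → 𝒢 G → ∀ r {m} (H : Graph m) → ShallowMinor r H G →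
  edgeCount H ≤ f r * m

traces : ∀ {n} → Graph n → Subset n → List (Subset n)
traces {n} G X =
  deduplicate (VecP.≡-dec BoolP._≟_)
    (map (λ u → N G u ∩ X) (filter (λ u → ¬? (u ∈? X)) (allFin n)))

numTraces : ∀ {n} → Graph n → Subset n → ℕ
numTraces G X = length (traces G X)

BoundedThreshold : ∀ {n} → ℕ → (Fin n → ℕ) → Set
BoundedThreshold {n} p t = ∀ v → 1 ≤ t v × t v ≤ p

IsYes : ∀ {n} → Graph n → (Fin n → ℕ) → ℕ → Subset n → Set
IsYes {n} G t k K = Σ (Subset n) λ S →
  S ⊆ K × k ≤ ∣ S ∣ × (∀ v → ∣ N G v ∩ S ∣ < t v)

deleteVertex : ∀ {n} → Graph n → Fin n → Graph (pred n)
deleteVertex {suc m} G v = record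
  { adj    = λ i j → adj G (punchIn v i) (punchIn v j)
  ; sym    = λ i j → sym G (punchIn v i) (punchIn v j)
  ; irrefl = λ i → irrefl G (punchIn v i)
  }

restrictFun : ∀ {n} {A : Set} → (Fin n → A) → Fin n → Fin (pred n) → A
restrictFun {suc m} f v i = f (punchIn v i)

restrictSet : ∀ {n} → Subset n → Fin n → Subset (pred n)
restrictSet {suc m} K v = tabulate (λ i → lookup K (punchIn v i))

-- If K is nonempty, the
-- n − |K| vertices outside K realise at most (a/b)|K| < n − |K| traces on K,
-- so two of them, x and y, have the same neighbourhood in K. Every solution
-- lies inside K, so x and y see the same number of solution vertices, and the
-- harmlessness constraint at the one with the larger threshold, say y, is
-- implied by the constraint at the other. Hence y can be deleted: solutions
-- of G − y are exactly the solutions of G, which avoid y. If K is empty the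
-- only solution is ∅, which is harmless because all thresholds are positive,
-- so any vertex can be deleted.
module Submission where

open import Defs hiding (sym)
open import Data.Nat using (ℕ; zero; suc; _+_; _*_; _≤_; _<_)
open import Data.Nat.Properties
  using (+-suc; +-monoˡ-≤; +-cancelʳ-<; *-cancelˡ-<; *-comm; *-distribʳ-+; ≤-total; <-≤-trans)
open import Data.Bool using (Bool; _∧_)
open import Data.Fin using (Fin; zero; suc; punchIn; punchOut; _≟_)
open import Data.Fin.Properties using (punchIn-punchOut; pigeonhole; <⇒≢)
open import Data.Fin.Subset using (Subset; inside; outside; _∈_; _∉_; _⊆_; _∩_; ∣_∣; Nonempty; Empty)
open import Data.Fin.Subset.Properties using (_∈?_; nonempty?; Empty-unique; ∣⊥∣≡0; x∈p∩q⁻)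
open import Data.Vec using (Vec; []; _∷_; lookup; insertAt)
import Data.Vec.Properties as Vec
import Data.Bool.Properties as Bool
open import Data.List using (List; length; filter; allFin)
import Data.List as List
open import Data.List.Membership.Propositional using () renaming (_∈_ to _∈ˡ_)
open import Data.List.Membership.Propositional.Properties using (∈-lookup; ∈-map⁺; ∈-filter⁻; ∈-deduplicate⁺)
open import Data.List.Relation.Unary.Any using (index)
open import Data.List.Relation.Unary.Any.Properties using (lookup-index)
import Data.List.Relation.Unary.All as All
open import Data.List.Relation.Unary.AllPairs using (_∷_)
open import Data.List.Relation.Unary.Unique.Propositional using (Unique)
open import Data.List.Relation.Unary.Unique.Propositional.Properties using (allFin⁺; filter⁺)
open import Data.Product using (Σ; ∃₂; _×_; _,_; proj₁; proj₂)
open import Data.Sum using (inj₁; inj₂)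
open import Function using (_∘_)
open import Function.Bundles using (_⇔_; mk⇔)
open import Relation.Binary.PropositionalEquality
open import Relation.Nullary using (¬_; yes; no; contradiction)
open import Relation.Nullary.Decidable using (¬?)

private
  variable
    A B : Set
    m n : ℕ

lookup-injective : {xs : List A} → Unique xs → ∀ i j → List.lookup xs i ≡ List.lookup xs j → i ≡ j
lookup-injective (_ ∷ _)      zero    zero    _  = refl
lookup-injective (x∉xs ∷ _)   zero    (suc j) eq = contradiction eq (All.lookup x∉xs (∈-lookup j))
lookup-injective (x∉xs ∷ _)   (suc i) zero    eq = contradiction (sym eq) (All.lookup x∉xs (∈-lookup i))
lookup-injective (_ ∷ xs!)    (suc i) (suc j) eq = cong suc (lookup-injective xs! i j eq)

pigeonhole-list : (f : A → B) {xs : List A} {ys : List B} → Unique xs →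
                  (∀ {x} → x ∈ˡ xs → f x ∈ˡ ys) → length ys < length xs →
                  ∃₂ λ x y → x ∈ˡ xs × y ∈ˡ xs × x ≢ y × f x ≡ f y
pigeonhole-list f {xs} {ys} xs! f∈ys |ys|<|xs|
  with i , j , i<j , same-index ← pigeonhole |ys|<|xs| (index ∘ f∈ys ∘ ∈-lookup)
  = List.lookup xs i , List.lookup xs j , ∈-lookup i , ∈-lookup j
  , (<⇒≢ i<j ∘ lookup-injective xs! i j)
  , trans (lookup-index (f∈ys (∈-lookup i)))
          (trans (cong (List.lookup ys) same-index) (sym (lookup-index (f∈ys (∈-lookup j)))))

lookup-ext : {xs ys : Vec A n} → (∀ i → lookup xs i ≡ lookup ys i) → xs ≡ ys
lookup-ext {xs = xs} {ys} eq =
  trans (sym (Vec.tabulate∘lookup xs)) (trans (Vec.tabulate-cong eq) (Vec.tabulate∘lookup ys))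

∈-transport : {p : Subset m} {q : Subset n} {x : Fin m} {y : Fin n} → lookup p x ≡ lookup q y → x ∈ p → y ∈ q
∈-transport {q = q} {y = y} eq x∈p = Vec.lookup⇒[]= y q (trans (sym eq) (Vec.[]=⇒lookup x∈p))

∉⇒lookup≡outside : {p : Subset n} {x : Fin n} → x ∉ p → lookup p x ≡ outside
∉⇒lookup≡outside {p = p} {x} x∉p with lookup p x in eq
... | inside  = contradiction (Vec.lookup⇒[]= x p eq) x∉p
... | outside = refl

∩-cong-⊆ : {p q K S : Subset n} → p ∩ K ≡ q ∩ K → S ⊆ K → p ∩ S ≡ q ∩ S
∩-cong-⊆ {p = p} {q} {K} {S} same S⊆K = lookup-ext λ i → begin
  lookup (p ∩ S) i              ≡⟨ Vec.lookup-zipWith _∧_ i p S ⟩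
  lookup p i ∧ lookup S i       ≡⟨ agree-on-S i (lookup S i) refl ⟩
  lookup q i ∧ lookup S i       ≡⟨ Vec.lookup-zipWith _∧_ i q S ⟨
  lookup (q ∩ S) i              ∎
  where
  open ≡-Reasoning
  agree-on-S : ∀ i b → lookup S i ≡ b → lookup p i ∧ b ≡ lookup q i ∧ b
  agree-on-S i outside _ = trans (Bool.∧-zeroʳ _) (sym (Bool.∧-zeroʳ _))
  agree-on-S i inside  i∈S = begin
    lookup p i ∧ inside   ≡⟨ Bool.∧-identityʳ _ ⟩
    lookup p i            ≡⟨ Bool.∧-identityʳ _ ⟨
    lookup p i ∧ inside   ≡⟨ cong (lookup p i ∧_) i∈K ⟨
    lookup p i ∧ lookup K i ≡⟨ Vec.lookup-zipWith _∧_ i p K ⟨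
    lookup (p ∩ K) i      ≡⟨ cong (λ r → lookup r i) same ⟩
    lookup (q ∩ K) i      ≡⟨ Vec.lookup-zipWith _∧_ i q K ⟩
    lookup q i ∧ lookup K i ≡⟨ cong (lookup q i ∧_) i∈K ⟩
    lookup q i ∧ inside   ∎
    where i∈K = Vec.[]=⇒lookup (S⊆K (Vec.lookup⇒[]= i S i∈S))

data PunchView {n} (v : Fin (suc n)) : Fin (suc n) → Set where
  at-v    : PunchView v v
  punched : ∀ i → PunchView v (punchIn v i)

punchView : (v x : Fin (suc n)) → PunchView v x
punchView v x with v ≟ x
... | yes refl = at-v
... | no v≢x   = subst (PunchView v) (punchIn-punchOut v≢x) (punched (punchOut v≢x))

lookup-restrictSet : (X : Subset (suc n)) (v : Fin (suc n)) (i : Fin n) →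
                     lookup (restrictSet X v) i ≡ lookup X (punchIn v i)
lookup-restrictSet X v = Vec.lookup∘tabulate (lookup X ∘ punchIn v)

restrictSet-mono : {S T : Subset (suc n)} (v : Fin (suc n)) → S ⊆ T → restrictSet S v ⊆ restrictSet T v
restrictSet-mono {S = S} {T} v S⊆T {i} i∈S′ =
  ∈-transport (sym (lookup-restrictSet T v i)) (S⊆T (∈-transport (lookup-restrictSet S v i) i∈S′))

restrictSet-∩ : (p q : Subset (suc n)) (v : Fin (suc n)) →
                restrictSet (p ∩ q) v ≡ restrictSet p v ∩ restrictSet q v
restrictSet-∩ p q v = lookup-ext λ i → begin
  lookup (restrictSet (p ∩ q) v) i                      ≡⟨ lookup-restrictSet (p ∩ q) v i ⟩
  lookup (p ∩ q) (punchIn v i)                          ≡⟨ Vec.lookup-zipWith _∧_ (punchIn v i) p q ⟩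
  lookup p (punchIn v i) ∧ lookup q (punchIn v i)       ≡⟨ cong₂ _∧_ (lookup-restrictSet p v i) (lookup-restrictSet q v i) ⟨
  lookup (restrictSet p v) i ∧ lookup (restrictSet q v) i ≡⟨ Vec.lookup-zipWith _∧_ i (restrictSet p v) (restrictSet q v) ⟨
  lookup (restrictSet p v ∩ restrictSet q v) i          ∎
  where open ≡-Reasoning

N-deleteVertex : (G : Graph (suc n)) (v : Fin (suc n)) (i : Fin n) →
                 N (deleteVertex G v) i ≡ restrictSet (N G (punchIn v i)) v
N-deleteVertex G v i =
  Vec.tabulate-cong λ j → sym (Vec.lookup∘tabulate (adj G (punchIn v i)) (punchIn v j))

restrictSet-insertAt : (S : Subset n) (v : Fin (suc n)) (b : Bool) → restrictSet (insertAt S v b) v ≡ S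
restrictSet-insertAt S v b = lookup-ext λ i →
  trans (lookup-restrictSet (insertAt S v b) v i) (Vec.insertAt-punchIn S v b i)

insertAt-restrictSet : (X : Subset (suc n)) (v : Fin (suc n)) →
                       insertAt (restrictSet X v) v (lookup X v) ≡ X
insertAt-restrictSet X v = lookup-ext λ x → lookup-at x (punchView v x)
  where
  lookup-at : ∀ x → PunchView v x → lookup (insertAt (restrictSet X v) v (lookup X v)) x ≡ lookup X x
  lookup-at _ at-v        = Vec.insertAt-lookup (restrictSet X v) v (lookup X v)
  lookup-at _ (punched i) =
    trans (Vec.insertAt-punchIn (restrictSet X v) v (lookup X v) i) (lookup-restrictSet X v i)

∣insertAt-outside∣ : (S : Subset n) (v : Fin (suc n)) → ∣ insertAt S v outside ∣ ≡ ∣ S ∣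
∣insertAt-outside∣ S              zero    = refl
∣insertAt-outside∣ (inside ∷ S)  (suc v) = cong suc (∣insertAt-outside∣ S v)
∣insertAt-outside∣ (outside ∷ S) (suc v) = ∣insertAt-outside∣ S v

∣restrictSet∣ : {X : Subset (suc n)} {v : Fin (suc n)} → v ∉ X → ∣ restrictSet X v ∣ ≡ ∣ X ∣
∣restrictSet∣ {X = X} {v} v∉X = begin
  ∣ restrictSet X v ∣                               ≡⟨ ∣insertAt-outside∣ (restrictSet X v) v ⟨
  ∣ insertAt (restrictSet X v) v outside ∣          ≡⟨ cong (λ b → ∣ insertAt (restrictSet X v) v b ∣) (∉⇒lookup≡outside v∉X) ⟨
  ∣ insertAt (restrictSet X v) v (lookup X v) ∣     ≡⟨ cong ∣_∣ (insertAt-restrictSet X v) ⟩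
  ∣ X ∣                                             ∎
  where open ≡-Reasoning

v∉insertAt-outside : (S : Subset n) (v : Fin (suc n)) → v ∉ insertAt S v outside
v∉insertAt-outside S v v∈ with () ← trans (sym (Vec.insertAt-lookup S v outside)) (Vec.[]=⇒lookup v∈)

insertAt-outside-⊆ : {S : Subset n} {K : Subset (suc n)} (v : Fin (suc n)) →
                     S ⊆ restrictSet K v → insertAt S v outside ⊆ K
insertAt-outside-⊆ {S = S} {K} v S⊆K' {x} x∈ with punchView v x
... | at-v      = contradiction x∈ (v∉insertAt-outside S v)
... | punched i = ∈-transport (lookup-restrictSet K v i)
                    (S⊆K' (∈-transport (Vec.insertAt-punchIn S v outside i) x∈))

∣N∩S∣-deleteVertex : (G : Graph (suc n)) {S : Subset (suc n)} {v : Fin (suc n)} → v ∉ S → (i : Fin n) →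
                     ∣ N (deleteVertex G v) i ∩ restrictSet S v ∣ ≡ ∣ N G (punchIn v i) ∩ S ∣
∣N∩S∣-deleteVertex G {S} {v} v∉S i = begin
  ∣ N (deleteVertex G v) i ∩ restrictSet S v ∣           ≡⟨ cong (λ Y → ∣ Y ∩ restrictSet S v ∣) (N-deleteVertex G v i) ⟩
  ∣ restrictSet (N G (punchIn v i)) v ∩ restrictSet S v ∣ ≡⟨ cong ∣_∣ (restrictSet-∩ (N G (punchIn v i)) S v) ⟨
  ∣ restrictSet (N G (punchIn v i) ∩ S) v ∣               ≡⟨ ∣restrictSet∣ (v∉S ∘ proj₂ ∘ x∈p∩q⁻ (N G (punchIn v i)) S) ⟩
  ∣ N G (punchIn v i) ∩ S ∣                               ∎
  where open ≡-Reasoning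

RedundantConstraint : Graph n → (Fin n → ℕ) → Subset n → Fin n → Set
RedundantConstraint {n} G t K v = (S : Subset n) → S ⊆ K →
  (∀ u → u ≢ v → ∣ N G u ∩ S ∣ < t u) → ∣ N G v ∩ S ∣ < t v

IsYes-deleteVertex-⇔ : (G : Graph (suc n)) (t : Fin (suc n) → ℕ) (k : ℕ) {K : Subset (suc n)} {v : Fin (suc n)} →
                       v ∉ K → RedundantConstraint G t K v →
                       IsYes G t k K ⇔ IsYes (deleteVertex G v) (restrictFun t v) k (restrictSet K v)
IsYes-deleteVertex-⇔ G t k {K} {v} v∉K redundant = mk⇔ restrict extend
  where
  restrict : IsYes G t k K → IsYes (deleteVertex G v) (restrictFun t v) k (restrictSet K v)
  restrict (S , S⊆K , k≤∣S∣ , harmless) =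
    restrictSet S v , restrictSet-mono v S⊆K , subst (k ≤_) (sym (∣restrictSet∣ v∉S)) k≤∣S∣ ,
    λ i → subst (_< t (punchIn v i)) (sym (∣N∩S∣-deleteVertex G v∉S i)) (harmless (punchIn v i))
    where v∉S = v∉K ∘ S⊆K

  extend : IsYes (deleteVertex G v) (restrictFun t v) k (restrictSet K v) → IsYes G t k K
  extend (S′ , S′⊆K′ , k≤∣S′∣ , harmless′) =
    S , S⊆K , subst (k ≤_) (sym (∣insertAt-outside∣ S′ v)) k≤∣S′∣ , harmless
    where
    S = insertAt S′ v outside
    S⊆K = insertAt-outside-⊆ v S′⊆K′

    harmless-punched : ∀ i → ∣ N G (punchIn v i) ∩ S ∣ < t (punchIn v i)
    harmless-punched i = subst (_< t (punchIn v i)) degree (harmless′ i)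
      where
      degree : ∣ N (deleteVertex G v) i ∩ S′ ∣ ≡ ∣ N G (punchIn v i) ∩ S ∣
      degree = trans (cong (λ Y → ∣ N (deleteVertex G v) i ∩ Y ∣) (sym (restrictSet-insertAt S′ v outside)))
                     (∣N∩S∣-deleteVertex G (v∉insertAt-outside S′ v) i)

    harmless-off-v : ∀ u → u ≢ v → ∣ N G u ∩ S ∣ < t u
    harmless-off-v u u≢v with punchView v u
    ... | at-v      = contradiction refl u≢v
    ... | punched i = harmless-punched i

    harmless : ∀ u → ∣ N G u ∩ S ∣ < t u
    harmless u with punchView v u
    ... | at-v      = redundant S S⊆K harmless-off-v
    ... | punched i = harmless-punched i

redundant-∅ : (G : Graph n) {t : Fin n → ℕ} {K : Subset n} {v : Fin n} → ¬ Nonempty K → 1 ≤ t v →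
              RedundantConstraint G t K v
redundant-∅ {n} G {t} {v = v} K-empty 0<tv S S⊆K _ =
  subst (_< t v) (sym (trans (cong ∣_∣ (Empty-unique N∩S≡∅)) (∣⊥∣≡0 n))) 0<tv
  where
  N∩S≡∅ : Empty (N G v ∩ S)
  N∩S≡∅ (x , x∈) = K-empty (x , S⊆K (proj₂ (x∈p∩q⁻ (N G v) S x∈)))

redundant-twin : (G : Graph n) {t : Fin n → ℕ} {K : Subset n} {u v : Fin n} →
                 u ≢ v → t u ≤ t v → N G u ∩ K ≡ N G v ∩ K → RedundantConstraint G t K v
redundant-twin G {t} {v = v} u≢v tu≤tv twins S S⊆K harmless-off-v =
  subst (λ Y → ∣ Y ∣ < t v) (∩-cong-⊆ twins S⊆K) (<-≤-trans (harmless-off-v _ u≢v) tu≤tv)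

outsideOf : Subset n → List (Fin n)
outsideOf {n} X = filter (λ u → ¬? (u ∈? X)) (allFin n)

-- Stated for an arbitrary enumeration g of the indices so that the induction
-- can pass from allFin (suc n) to its tail, which is tabulate suc.
length-filter-∉ : (X : Subset n) (Y : Subset m) (g : Fin n → Fin m) → (∀ i → lookup Y (g i) ≡ lookup X i) →
                  length (filter (λ u → ¬? (u ∈? Y)) (List.tabulate g)) + ∣ X ∣ ≡ n
length-filter-∉ []            Y g same = refl
length-filter-∉ (inside ∷ X)  Y g same with g zero ∈? Y
... | yes _   = trans (+-suc _ _) (cong suc (length-filter-∉ X Y (g ∘ suc) (same ∘ suc)))
... | no g0∉Y = contradiction (Vec.lookup⇒[]= (g zero) Y (same zero)) g0∉Y
length-filter-∉ (outside ∷ X) Y g same with g zero ∈? Y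
... | yes g0∈Y with () ← trans (sym (Vec.[]=⇒lookup g0∈Y)) (same zero)
... | no _    = cong suc (length-filter-∉ X Y (g ∘ suc) (same ∘ suc))

length-outsideOf : (X : Subset n) → length (outsideOf X) + ∣ X ∣ ≡ n
length-outsideOf X = length-filter-∉ X X (λ i → i) (λ _ → refl)

fewer-traces : ∀ a b k ℓ T → k * (a + b) < (ℓ + k) * b → b * T ≤ a * k → T < ℓ
fewer-traces a b k ℓ T small bounded = *-cancelˡ-< b T ℓ (+-cancelʳ-< (b * k) (b * T) (b * ℓ) (begin-strict
  b * T + b * k   ≤⟨ +-monoˡ-≤ (b * k) bounded ⟩
  a * k + b * k   ≡⟨ *-distribʳ-+ k a b ⟨
  (a + b) * k     ≡⟨ *-comm (a + b) k ⟩
  k * (a + b)     <⟨ small ⟩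
  (ℓ + k) * b     ≡⟨ *-distribʳ-+ b ℓ k ⟩
  ℓ * b + k * b   ≡⟨ cong₂ _+_ (*-comm ℓ b) (*-comm k b) ⟩
  b * ℓ + b * k   ∎))
  where open Data.Nat.Properties.≤-Reasoning

twins-outside : (G : Graph n) (K : Subset n) → numTraces G K < length (outsideOf K) →
                ∃₂ λ x y → x ∉ K × y ∉ K × x ≢ y × N G x ∩ K ≡ N G y ∩ K
twins-outside {n} G K few
  with x , y , x∈ , y∈ , x≢y , twins ←
       pigeonhole-list (λ u → N G u ∩ K) (filter⁺ _ (allFin⁺ n))
                       (∈-deduplicate⁺ (Vec.≡-dec Bool._≟_) ∘ ∈-map⁺ (λ u → N G u ∩ K)) few
  = x , y , proj₂ (∈-filter⁻ _ {xs = allFin n} x∈) , proj₂ (∈-filter⁻ _ {xs = allFin n} y∈) , x≢y , twins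

redundant-of-twins : (G : Graph n) (t : Fin n → ℕ) {K : Subset n} {x y : Fin n} →
                     x ∉ K → y ∉ K → x ≢ y → N G x ∩ K ≡ N G y ∩ K →
                     Σ (Fin n) λ v → v ∉ K × RedundantConstraint G t K v
redundant-of-twins G t {x = x} {y} x∉K y∉K x≢y twins with ≤-total (t x) (t y)
... | inj₁ tx≤ty = y , y∉K , redundant-twin G x≢y tx≤ty twins
... | inj₂ ty≤tx = x , x∉K , redundant-twin G (x≢y ∘ sym) ty≤tx (sym twins)

lemma5 : (𝒢 : GraphClass) → BoundedExpansion 𝒢 →
         (a b : ℕ) → b ≢ 0 →
         (∀ {n} (G : Graph n) → 𝒢 G → (X : Subset n) → Nonempty X →
           b * numTraces G X ≤ a * ∣ X ∣) →
         (p : ℕ) {n : ℕ} (G : Graph n) → 𝒢 G →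
         (t : Fin n → ℕ) → BoundedThreshold p t → (k : ℕ) → (K : Subset n) →
         ∣ K ∣ * (a + b) < n * b →
         Σ (Fin n) λ v → v ∉ K ×
           (IsYes G t k K ⇔
            IsYes (deleteVertex G v) (restrictFun t v) k (restrictSet K v))
lemma5 𝒢 _ a b _ complexity p {zero} G _ t _ k K ()
lemma5 𝒢 _ a b _ complexity p {suc n} G G∈𝒢 t bounded k K small
  = let v , v∉K , redundant = redundantVertex in v , v∉K , IsYes-deleteVertex-⇔ G t k v∉K redundant
  where
  fewTraces : Nonempty K → numTraces G K < length (outsideOf K)
  fewTraces K-nonempty = fewer-traces a b ∣ K ∣ (length (outsideOf K)) (numTraces G K)
    (subst (λ m → ∣ K ∣ * (a + b) < m * b) (sym (length-outsideOf K)) small)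
    (complexity G G∈𝒢 K K-nonempty)

  redundantVertex : Σ (Fin (suc n)) λ v → v ∉ K × RedundantConstraint G t K v
  redundantVertex with nonempty? K
  ... | no K-empty = zero , (λ 0∈K → K-empty (zero , 0∈K)) , redundant-∅ G K-empty (proj₁ (bounded zero))
  ... | yes K-nonempty with x , y , x∉K , y∉K , x≢y , twins ← twins-outside G K (fewTraces K-nonempty)
    = redundant-of-twins G t x∉K y∉K x≢y twins
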